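{- Let $A\in\mathbb{R}^{n\times m}$ with $m\ge n$ and rank $n$, let $T$ be a $d$-dimensional subspace and $L=\{i:A_i\in T\}$ with $|L|>\frac{d}{n}m$, and suppose that a set of $n$ columns of $A$ is linearly independent if and only if at most $d$ of them are in $L$. Run the following procedure: set $U=[m]$; while $|U|>n$: for each $i\in U$ in turn, check whether $\frac{n}{|U\setminus\{i\}|}\mathbf{1}\in K_{A_{U\setminus\{i\}}}$, and at the first $i$ for which the answer is NO, set $U=U\setminus\{i\}$ and return to the while test. Then after exiting the while loop, $|U\cap L|\ge d+1$.
   Context: $A_i$ is the $i$-th column of $A$ and $A_W$ is the submatrix of columns indexed by $W\subseteq[m]$. For a matrix $B$ with columns $b_1,\dots,b_k\in\mathbb{R}^n$, $K_B\subseteq\mathbb{R}^k$ is the basis polytope: the convex hull of indicator vectors of $n$-element sets of column indices whose columns are linearly independent. $\mathbf{1}$ is the all-ones vector of the appropriate dimension. -}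

module Defs where

open import Level using (Level; _⊔_) renaming (suc to lsuc)
open import Data.Nat using (ℕ; zero; suc; _≤_; _<_)
open import Relation.Binary.PropositionalEquality using (_≡_)
open import Relation.Binary.Construct.Closure.ReflexiveTransitive using (Star)
open import Data.Fin using (Fin; toℕ) renaming (zero to fzero; suc to fsuc)
open import Data.Fin.Subset using (Subset; Side; inside; outside; _∈_; _∉_; _⊆_; ∣_∣; _-_; ⊤)
open import Data.Vec using (lookup)
open import Data.Product using (Σ; _×_; ∃)
open import Relation.Nullary using (¬_)
open import Relation.Binary using (Rel)
open import Relation.Binary.Structures using (IsTotalOrder)
open import Algebra.Structures using (IsCommutativeRing)

-- An ordered field (the role played by ℝ in the paper).
record OrderedField (c ℓ ℓ' : Level) : Set (lsuc (c ⊔ ℓ ⊔ ℓ')) where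
  infixl 7 _*F_
  infixl 6 _+F_
  infix 4 _≈_ _≤F_
  field
    Carrier : Set c
    _≈_ : Rel Carrier ℓ
    _≤F_ : Rel Carrier ℓ'
    _+F_ _*F_ : Carrier → Carrier → Carrier
    -_ : Carrier → Carrier
    0# 1# : Carrier
    isCommutativeRing : IsCommutativeRing _≈_ _+F_ _*F_ -_ 0# 1#
    0≉1 : ¬ (0# ≈ 1#)
    _⁻¹ : (x : Carrier) → ¬ (x ≈ 0#) → Carrier
    ⁻¹-inverse : (x : Carrier) (p : ¬ (x ≈ 0#)) → x *F (x ⁻¹) p ≈ 1#
    isTotalOrder : IsTotalOrder _≈_ _≤F_
    +-mono-≤ : ∀ {x y} z → x ≤F y → x +F z ≤F y +F z
    *-nonneg : ∀ {x y} → 0# ≤F x → 0# ≤F y → 0# ≤F x *F y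

module _ {c ℓ ℓ' : Level} (F : OrderedField c ℓ ℓ') where
  open OrderedField F

  ∑ : (k : ℕ) → (Fin k → Carrier) → Carrier
  ∑ zero f = 0#
  ∑ (suc k) f = f fzero +F ∑ k (λ j → f (fsuc j))

  fromℕ : ℕ → Carrier
  fromℕ zero = 0#
  fromℕ (suc k) = 1# +F fromℕ k

  Vect : ℕ → Set c
  Vect n = Fin n → Carrier

  Matrix : ℕ → ℕ → Set c
  Matrix n m = Fin n → Fin m → Carrier

  col : ∀ {n m} → Matrix n m → Fin m → Vect n
  col A i r = A r i

  LinIndepFam : ∀ {n k} → (Fin k → Vect n) → Set (c ⊔ ℓ)
  LinIndepFam {n} {k} v =
    (a : Fin k → Carrier) → (∀ r → ∑ k (λ j → a j *F v j r) ≈ 0#) → ∀ j → a j ≈ 0#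

  IndepCols : ∀ {n m} → Matrix n m → Subset m → Set (c ⊔ ℓ)
  IndepCols {n} {m} A S =
    (a : Fin m → Carrier) → (∀ j → j ∉ S → a j ≈ 0#) →
    (∀ r → ∑ m (λ j → a j *F A r j) ≈ 0#) → ∀ j → a j ≈ 0#

  HasRank : ∀ {n m} → Matrix n m → ℕ → Set (c ⊔ ℓ)
  HasRank {n} {m} A k =
    Σ (Subset m) (λ S → ∣ S ∣ ≡ k × IndepCols A S) ×
    ((S : Subset m) → IndepCols A S → ∣ S ∣ ≤ k)

  -- v lies in the span of the family t (the subspace T with basis t)
  InSpan : ∀ {n d} → Vect n → (Fin d → Vect n) → Set (c ⊔ ℓ)
  InSpan {n} {d} v t = Σ (Fin d → Carrier) (λ a → ∀ r → v r ≈ ∑ d (λ k → a k *F t k r))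

  indicator : Side → Carrier
  indicator inside = 1#
  indicator outside = 0#

  IsBasisOf : ∀ {n m} → Matrix n m → Subset m → Subset m → Set (c ⊔ ℓ)
  IsBasisOf {n} A W B = B ⊆ W × ∣ B ∣ ≡ n × IndepCols A B

  -- (n / |W|) 𝟏 ∈ K_{A_W}: the point with all coordinates (indexed by W) equal to n/|W|
  -- is a convex combination of indicator vectors of bases of A_W.
  -- The coordinate equation  Σ_j λ_j [i ∈ B_j] = n / |W|  is written multiplied
  -- out as  |W| · Σ_j λ_j [i ∈ B_j] = n.
  UniformInK : ∀ {n m} → Matrix n m → Subset m → Set (c ⊔ ℓ ⊔ ℓ')
  UniformInK {n} {m} A W =
    Σ ℕ λ k → Σ (Fin k → Subset m) λ B → Σ (Fin k → Carrier) λ w →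
      (∀ j → IsBasisOf A W (B j)) ×
      (∀ j → 0# ≤F w j) ×
      (∑ k w ≈ 1#) ×
      (∀ i → i ∈ W →
        fromℕ ∣ W ∣ *F ∑ k (λ j → w j *F indicator (lookup (B j) i)) ≈ fromℕ n)

  Step : ∀ {n m} → Matrix n m → Subset m → Subset m → Set (c ⊔ ℓ ⊔ ℓ')
  Step {n} {m} A U U' =
    n < ∣ U ∣ ×
    Σ (Fin m) λ i → i ∈ U × ¬ UniformInK A (U - i) ×
      (∀ j → j ∈ U → toℕ j < toℕ i → UniformInK A (U - j)) ×
      U' ≡ U - i

  ExitState : ∀ {n m} → Matrix n m → Subset m → Set (c ⊔ ℓ ⊔ ℓ')
  ExitState {n} A U = Star (Step A) ⊤ U × ∣ U ∣ ≤ n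

-- The last iteration of the while loop removes a column from a set of size n + 1, so on exit
-- |U| = n and the membership test failed for U.  If |U ∩ L| ≤ d, the hypothesis makes U a
-- basis, and then (n/|U|)𝟏 = 𝟏 is its own indicator vector, so the test would have succeeded.
-- If the loop never runs, then U = [m] with m = n, and |L| > d m / n = d.
module Submission where

open import Defs
open import Level using (Level)
open import Data.Nat using (ℕ; _≤_; _<_; _*_; suc; _+_; z≤n; s≤s)
open import Data.Nat.Properties
  using (≤-trans; ≤-antisym; ≤-pred; n≤1+n; +-monoʳ-≤; +-suc; +-comm; ≤-reflexive; *-cancelʳ-<; _≤?_; ≰⇒>)
open import Data.Fin using (Fin)
open import Data.Fin.Subset using (Subset; _∈_; _∩_; ∣_∣; _─_; _-_; ⊤; inside; outside)
open import Data.Fin.Subset.Properties using (∣⁅x⁆∣≡1; ∣⊤∣≡n; ∩-identityˡ)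
open import Data.Product using (_×_; _,_)
open import Data.Sum using (_⊎_; inj₁; inj₂)
open import Data.Vec using (_∷_; []; lookup)
open import Data.Vec.Properties using ([]=⇒lookup)
open import Data.Empty using (⊥-elim)
open import Function.Bundles using (_⇔_; Equivalence)
open import Relation.Binary.PropositionalEquality using (_≡_; refl; sym; trans; cong; subst)
open import Relation.Binary.Construct.Closure.ReflexiveTransitive using (Star; ε; _◅_)
open import Relation.Nullary using (¬_; yes; no)
open import Algebra.Bundles using (CommutativeRing)
import Algebra.Properties.Ring as RingProperties
open import Relation.Binary.Structures using (IsTotalOrder)

∣p∣≤∣p─q∣+∣q∣ : ∀ {m} (p q : Subset m) → ∣ p ∣ ≤ ∣ p ─ q ∣ + ∣ q ∣
∣p∣≤∣p─q∣+∣q∣ []            []            = z≤n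
∣p∣≤∣p─q∣+∣q∣ (outside ∷ p) (outside ∷ q) = ∣p∣≤∣p─q∣+∣q∣ p q
∣p∣≤∣p─q∣+∣q∣ (outside ∷ p) (inside ∷ q)  = ≤-trans (∣p∣≤∣p─q∣+∣q∣ p q) (+-monoʳ-≤ _ (n≤1+n _))
∣p∣≤∣p─q∣+∣q∣ (inside ∷ p)  (outside ∷ q) = s≤s (∣p∣≤∣p─q∣+∣q∣ p q)
∣p∣≤∣p─q∣+∣q∣ (inside ∷ p)  (inside ∷ q)  =
  ≤-trans (s≤s (∣p∣≤∣p─q∣+∣q∣ p q)) (≤-reflexive (sym (+-suc _ _)))

∣p∣≤1+∣p-x∣ : ∀ {m} (p : Subset m) (x : Fin m) → ∣ p ∣ ≤ suc ∣ p - x ∣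
∣p∣≤1+∣p-x∣ p x = ≤-trans (∣p∣≤∣p─q∣+∣q∣ p _)
  (≤-reflexive (trans (cong (∣ p - x ∣ +_) (∣⁅x⁆∣≡1 x)) (+-comm _ 1)))

module _ {c ℓ ℓ' : Level} (F : OrderedField c ℓ ℓ') where
  open OrderedField F

  commutativeRing : CommutativeRing c ℓ
  commutativeRing = record { isCommutativeRing = isCommutativeRing }

  open CommutativeRing commutativeRing
    using (ring; *-cong; *-identityˡ; *-identityʳ; +-identityˡ; +-identityʳ; -‿inverseʳ)
    renaming (refl to ≈-refl; trans to ≈-trans)
  open RingProperties ring using (-‿involutive; -1*x≈-x)
  open IsTotalOrder isTotalOrder using (total; ≤-respˡ-≈; ≤-respʳ-≈)

  -- If 1 ≤ 0 then 0 ≤ -1, and 1 = (-1)(-1) is a product of nonnegatives.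
  0≤1 : 0# ≤F 1#
  0≤1 with total 0# 1#
  ... | inj₁ 0≤1 = 0≤1
  ... | inj₂ 1≤0 = ≤-respʳ-≈ -1*-1≈1 (*-nonneg 0≤-1 0≤-1)
    where
    0≤-1 : 0# ≤F - 1#
    0≤-1 = ≤-respʳ-≈ (+-identityˡ (- 1#)) (≤-respˡ-≈ (-‿inverseʳ 1#) (+-mono-≤ (- 1#) 1≤0))
    -1*-1≈1 : - 1# *F - 1# ≈ 1#
    -1*-1≈1 = ≈-trans (-1*x≈-x (- 1#)) (-‿involutive 1#)

  basis⇒UniformInK : ∀ {n m} (A : Matrix F n m) (U : Subset m) →
    ∣ U ∣ ≡ n → IndepCols F A U → UniformInK F A U
  basis⇒UniformInK {n} A U ∣U∣≡n indep =
    1 , (λ _ → U) , (λ _ → 1#) , (λ _ → (λ x∈U → x∈U) , ∣U∣≡n , indep) , (λ _ → 0≤1) ,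
    +-identityʳ 1# , coordinate
    where
    coordinate : ∀ i → i ∈ U →
      fromℕ F ∣ U ∣ *F ∑ F 1 (λ _ → 1# *F indicator F (lookup U i)) ≈ fromℕ F n
    coordinate i i∈U rewrite ∣U∣≡n | []=⇒lookup i∈U =
      ≈-trans (*-cong ≈-refl (≈-trans (+-identityʳ _) (*-identityˡ 1#))) (*-identityʳ _)

  Star-Step⇒≡⊎lastTestFailed : ∀ {n m} (A : Matrix F n m) {V U : Subset m} →
    Star (Step F A) V U → V ≡ U ⊎ (n ≤ ∣ U ∣ × ¬ UniformInK F A U)
  Star-Step⇒≡⊎lastTestFailed A ε = inj₁ refl
  Star-Step⇒≡⊎lastTestFailed A (_◅_ {i = V} (n<∣V∣ , i , _ , failed , _ , refl) steps)
    with Star-Step⇒≡⊎lastTestFailed A steps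
  ... | inj₂ later = inj₂ later
  ... | inj₁ refl  = inj₂ (≤-pred (≤-trans n<∣V∣ (∣p∣≤1+∣p-x∣ V i)) , failed)

mainTheorem9 : ∀ {c ℓ ℓ' : Level} (F : OrderedField c ℓ ℓ') (n m d : ℕ)
    (A : Matrix F n m) → n ≤ m → HasRank F A n →
    (t : Fin d → Vect F n) → LinIndepFam F t →
    (L : Subset m) → (∀ i → (i ∈ L) ⇔ InSpan F (col F A i) t) →
    d * m < ∣ L ∣ * n →
    ((S : Subset m) → ∣ S ∣ ≡ n →
    IndepCols F A S ⇔ (∣ S ∩ L ∣ ≤ d)) →
    (U : Subset m) → ExitState F A U → suc d ≤ ∣ U ∩ L ∣
mainTheorem9 F n m d A n≤m _ t _ L _ dense indep⇔ U (run , ∣U∣≤n)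
  with Star-Step⇒≡⊎lastTestFailed F A run
... | inj₁ refl rewrite ∩-identityˡ L | ∣⊤∣≡n m =
  *-cancelʳ-< n d ∣ L ∣ (subst (λ k → d * k < ∣ L ∣ * n) (≤-antisym ∣U∣≤n n≤m) dense)
... | inj₂ (n≤∣U∣ , failed) with ∣ U ∩ L ∣ ≤? d
...   | yes few = ⊥-elim (failed (basis⇒UniformInK F A U ∣U∣≡n (Equivalence.from (indep⇔ U ∣U∣≡n) few)))
  where
  ∣U∣≡n : ∣ U ∣ ≡ n
  ∣U∣≡n = ≤-antisym ∣U∣≤n n≤∣U∣
...   | no many = ≰⇒> many
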